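{- The cut polytope $\mathrm{Cut}^{\square}(K_5)$ of the complete graph on $5$ vertices is not compressed.
   Context: For a graph $G=([n],E)$ and $S\subseteq[n]$, $\delta_G(S)\in\mathbb{R}^E$ has $\delta_G(S)_{ij}=1$ if $|S\cap\{i,j\}|=1$ and $0$ otherwise; $\mathrm{Cut}^{\square}(G)=\mathrm{conv}(\delta_G(S)\mid S\subseteq[n])$. Compressed is with respect to the smallest lattice containing these points: a lattice polytope is compressed if every pulling triangulation using its lattice points (recursively: cone from the first point over pulling triangulations, with induced ordering, of the facets not containing it) is unimodular, i.e. each simplex has the minimal volume among simplices spanned by lattice points of the polytope. -}

module Defs where

open import Data.Nat using (ℕ; zero; suc)
import Data.Nat
import Data.Fin
open import Data.Bool using (Bool; true; false; _xor_)
open import Data.Fin using (Fin; zero; suc)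
open import Data.Integer as ℤ using (ℤ; +_; -_; ∣_∣)
open import Data.Rational as ℚ using (ℚ; _/_; 0ℚ; 1ℚ)
open import Data.Vec using (Vec; []; _∷_; lookup; tabulate; map; removeAt; zipWith; foldr)
open import Data.List as List using (List; []; _∷_; _++_)
open import Data.List.Relation.Unary.All using (All)
open import Data.List.Relation.Unary.Unique.Propositional using (Unique)
import Data.List.Membership.Propositional as LM
import Data.Vec.Membership.Propositional as VM
open import Data.Product using (Σ; ∃; _×_; _,_)
open import Data.Sum using (_⊎_)
open import Data.Empty using (⊥)
open import Relation.Nullary using (¬_)
open import Relation.Binary.PropositionalEquality using (_≡_)
open import Function.Bundles using (_⇔_)

VSubset : Set
VSubset = Vec Bool 5

allSubsets : (n : ℕ) → List (Vec Bool n)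
allSubsets zero    = [] ∷ []
allSubsets (suc n) =
  List.map (true ∷_) (allSubsets n) ++ List.map (false ∷_) (allSubsets n)

-- The 10 edges {i,j}, i < j, of K₅; an edge index e : Fin 10 is a coordinate of ℝ^E.
edges : Vec (Fin 5 × Fin 5) 10
edges = (f0 , f1) ∷ (f0 , f2) ∷ (f0 , f3) ∷ (f0 , f4) ∷ (f1 , f2)
      ∷ (f1 , f3) ∷ (f1 , f4) ∷ (f2 , f3) ∷ (f2 , f4) ∷ (f3 , f4) ∷ []
  where
  f0 f1 f2 f3 f4 : Fin 5
  f0 = zero
  f1 = suc zero
  f2 = suc (suc zero)
  f3 = suc (suc (suc zero))
  f4 = suc (suc (suc (suc zero)))

Pt : Set
Pt = Vec ℤ 10

b2z : Bool → ℤ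
b2z true  = + 1
b2z false = + 0

δ : VSubset → Pt
δ S = tabulate λ e → cutEdge (lookup edges e)
  where
  cutEdge : Fin 5 × Fin 5 → ℤ
  cutEdge (i , j) = b2z (lookup S i xor lookup S j)

sumℤ : List ℤ → ℤ
sumℤ = List.foldr ℤ._+_ (+ 0)

sumℚ : List ℚ → ℚ
sumℚ = List.foldr ℚ._+_ 0ℚ

toℚ : ℤ → ℚ
toℚ z = z / 1

InLattice : Pt → Set
InLattice x = Σ (VSubset → ℤ) λ a →
  x ≡ tabulate λ e → sumℤ (List.map (λ S → a S ℤ.* lookup (δ S) e) (allSubsets 5))

-- x lies in Cut^□(K₅) = conv(δ(S) | S ⊆ [5]) (rational convex combination;
-- x has integer coordinates so rational coefficients suffice).
InCutPolytope : Pt → Set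
InCutPolytope x = Σ (VSubset → ℚ) λ λc →
    (∀ S → 0ℚ ℚ.≤ λc S)
  × sumℚ (List.map λc (allSubsets 5)) ≡ 1ℚ
  × (∀ e → toℚ (lookup x e)
            ≡ sumℚ (List.map (λ S → λc S ℚ.* toℚ (lookup (δ S) e)) (allSubsets 5)))

LatticePt : Pt → Set
LatticePt x = InLattice x × InCutPolytope x

-- Faces and facets (a face is identified with its set of lattice points)

PtSet : Set₁
PtSet = Pt → Set

dot : Pt → Pt → ℤ
dot c x = foldr (λ _ → ℤ) ℤ._+_ (+ 0) (zipWith ℤ._*_ c x)

-- F is a face of Cut(K₅): there is a valid inequality c·x ≤ b for the polytope
-- (checked on its generators δ(S)) whose equality set among lattice points is F.
IsFace : PtSet → Set
IsFace F = Σ Pt λ c → Σ ℤ λ b →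
    (∀ S → dot c (δ S) ℤ.≤ b)
  × (∀ x → F x ⇔ (LatticePt x × dot c x ≡ b))

_⊆ₚ_ : PtSet → PtSet → Set
F ⊆ₚ G = ∀ x → F x → G x

_⊊ₚ_ : PtSet → PtSet → Set
F ⊊ₚ G = F ⊆ₚ G × ∃ λ x → G x × ¬ F x

IsFacetOf : PtSet → PtSet → Set₁
IsFacetOf F Q = IsFace F × F ⊊ₚ Q
  × (∀ G → IsFace G → F ⊊ₚ G → G ⊆ₚ Q → Q ⊆ₚ G)

IsOrdering : List Pt → Set
IsOrdering ord = Unique ord × (∀ x → (x LM.∈ ord) ⇔ LatticePt x)

FirstIn : List Pt → PtSet → Pt → Set
FirstIn ord Q v = Σ (List Pt) λ pre → Σ (List Pt) λ post →
  ord ≡ pre ++ (v ∷ post) × Q v × All (λ y → ¬ Q y) pre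

-- Pulling ord Q σ : σ (a set of lattice points, the vertex set of a simplex)
-- is a simplex of the pulling triangulation of the face Q w.r.t. ord:
-- the empty face is triangulated by the empty simplex; otherwise, with v the
-- first point of Q, simplices are v * τ with τ in the pulling triangulation
-- of a facet F of Q not containing v.
data Pulling (ord : List Pt) : PtSet → PtSet → Set₁ where
  empty : ∀ {Q σ} → (∀ x → ¬ Q x) → (∀ x → ¬ σ x) → Pulling ord Q σ
  cone  : ∀ {Q σ} (v : Pt) (F τ : PtSet) →
          FirstIn ord Q v → IsFacetOf F Q → ¬ F v → Pulling ord F τ →
          (∀ x → σ x ⇔ (x ≡ v ⊎ τ x)) → Pulling ord Q σ

-- Volumes (up to the constant factor 10! · [ℤ^E : L], irrelevant for comparison)

sign : ℕ → ℤ
sign zero          = + 1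
sign (suc zero)    = - (+ 1)
sign (suc (suc k)) = sign k

det : ∀ {n} → Vec (Vec ℤ n) n → ℤ
det {zero}  []       = + 1
det {suc n} (r ∷ rs) =
  foldr (λ _ → ℤ) ℤ._+_ (+ 0)
    (tabulate λ j → sign (Data.Fin.toℕ j) ℤ.* lookup r j
                      ℤ.* det (map (λ row → removeAt row j) rs))

-- |det(v₁ − v₀, …, v₁₀ − v₀)|: 10!·(Euclidean volume) of conv(v₀,…,v₁₀).
vol : Vec Pt 11 → ℕ
vol (v₀ ∷ vs) = ∣ det (map (λ v → zipWith ℤ._-_ v v₀) vs) ∣

Enumerates : Vec Pt 11 → PtSet → Set
Enumerates vs σ = ∀ x → σ x ⇔ (x VM.∈ vs)

MinimalVolume : Vec Pt 11 → Set
MinimalVolume vs = 0 Data.Nat.< vol vs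
  × (∀ (ws : Vec Pt 11) → All LatticePt (Data.Vec.toList ws) →
       0 Data.Nat.< vol ws → vol vs Data.Nat.≤ vol ws)

Unimodular : PtSet → Set
Unimodular σ = ∀ vs → Enumerates vs σ → MinimalVolume vs

CutK5Compressed : Set₁
CutK5Compressed = ∀ ord → IsOrdering ord → ∀ σ → Pulling ord LatticePt σ → Unimodular σ

-- Every lattice point of Cut(K₅) is one of its sixteen vertices δ(S), 0 ∉ S: membership in the
-- polytope forces 0/1 coordinates, and membership in the cut lattice forces every triangle sum
-- x_ij + x_ik + x_jk to be even, so that x_ij = x_0i xor x_0j. Pulling the vertices in a suitable
-- order first cones the apex δ({3,4}) over the pentagonal facet, which is a 9-simplex, and then
-- pulls the vertices of that simplex one at a time along a flag of its faces. The simplex obtained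
-- has normalised volume 192, whereas the lattice points also span a simplex of volume 64, so this
-- pulling triangulation is not unimodular.

module Submission where

open import Defs
open import Algebra.Bundles using (AbelianGroup)
open import Data.Bool using (Bool; true; false; _xor_; if_then_else_)
import Data.Bool as Bool
open import Data.Bool.ListAction using (any)
open import Data.Empty using (⊥; ⊥-elim)
open import Data.Fin as Fin using (Fin; #_)
open import Data.Integer as ℤ using (ℤ; +_; -[1+_]; +[1+_]; +≤+; _+_; _*_; _≤_; ∣_∣)
open import Data.Integer.Divisibility.Signed using (_∣_; divides; ∣m∣n⇒∣m+n; ∣n⇒∣m*n)
open import Data.Integer.GCD using (gcd; gcd-zeroʳ)
import Data.Integer.Properties as ℤP
open import Data.Integer.Solver using (module +-*-Solver)
open import Data.List as L using (List; []; _∷_; _++_)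
import Data.List.Membership.DecPropositional as DecMembership
open import Data.List.Membership.Propositional using (_∈_)
open import Data.List.Membership.Propositional.Properties using (∈-map⁺; ∈-map⁻; ∈-++⁺ˡ; ∈-++⁺ʳ)
import Data.List.Properties as LP
open import Data.List.Relation.Unary.All as All using (All; []; _∷_)
open import Data.List.Relation.Unary.Any using (here)
open import Data.List.Relation.Unary.Any.Properties using (∷↔)
open import Data.Nat as ℕ using (ℕ; zero; suc)
import Data.Nat.Properties as ℕP
open import Data.Product using (∃; _×_; _,_; proj₁; proj₂)
open import Data.Rational as ℚ using (ℚ; 0ℚ; 1ℚ; ↥_; ↧_)
import Data.Rational.Properties as ℚP
open import Data.Sum as Sum using (_⊎_; inj₁; inj₂)
open import Data.Vec as V using (Vec; []; _∷_; lookup; tabulate)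
open import Data.Vec.Membership.Propositional.Properties using (∈-fromList⁺; ∈-fromList⁻)
import Data.Vec.Properties as VP
open import Function using (_∘_; id)
open import Function.Bundles using (Equivalence; _⇔_; mk⇔)
open import Function.Properties.Equivalence using () renaming (sym to ⇔-sym)
open import Function.Properties.Inverse using (↔⇒⇔)
open import Relation.Binary.PropositionalEquality
open import Relation.Nullary using (¬_; Dec; no; ¬?)
open import Relation.Nullary.Decidable using (from-yes; from-no; ⌊_⌋; _×-dec_; _⊎-dec_; _→-dec_)

open import Algebra.Properties.Group (AbelianGroup.group ℤP.+-0-abelianGroup)
  using () renaming (∙-cancelʳ to +-cancelʳ)
open +-*-Solver

-- Lattice points are cut vectors

allSubsets-complete : ∀ n (S : Vec Bool n) → S ∈ allSubsets n
allSubsets-complete zero    []      = here refl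
allSubsets-complete (suc n) (true ∷ S) =
  ∈-++⁺ˡ (∈-map⁺ (true ∷_) (allSubsets-complete n S))
allSubsets-complete (suc n) (false ∷ S) =
  ∈-++⁺ʳ (L.map (true ∷_) (allSubsets n)) (∈-map⁺ (false ∷_) (allSubsets-complete n S))

cuts : VSubset → Fin 10 → Bool
cuts S e = lookup S (proj₁ (lookup edges e)) xor lookup S (proj₂ (lookup edges e))

lookup-δ : ∀ S e → lookup (δ S) e ≡ b2z (cuts S e)
lookup-δ S = VP.lookup∘tabulate (b2z ∘ cuts S)

bit-weighted-sum-bounds : ∀ {A : Set} (w t : A → ℚ) → (∀ a → 0ℚ ℚ.≤ w a) →
  (∀ a → t a ≡ 0ℚ ⊎ t a ≡ 1ℚ) → ∀ as →
    0ℚ ℚ.≤ sumℚ (L.map (λ a → w a ℚ.* t a) as)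
  × sumℚ (L.map (λ a → w a ℚ.* t a) as) ℚ.≤ sumℚ (L.map w as)
bit-weighted-sum-bounds w t w≥0 t-bit [] = ℚP.≤-refl , ℚP.≤-refl
bit-weighted-sum-bounds w t w≥0 t-bit (a ∷ as) with bit-weighted-sum-bounds w t w≥0 t-bit as | t-bit a
... | lo , hi | inj₁ ta≡0 rewrite ta≡0 | ℚP.*-zeroʳ (w a) =
  ℚP.≤-trans lo (ℚP.≤-reflexive (sym (ℚP.+-identityˡ _))) , ℚP.+-mono-≤ (w≥0 a) hi
... | lo , hi | inj₂ ta≡1 rewrite ta≡1 | ℚP.*-identityʳ (w a) =
  ℚP.+-mono-≤ (w≥0 a) lo , ℚP.+-mono-≤ (ℚP.≤-refl {w a}) hi

↥-toℚ : ∀ z → ↥ (toℚ z) ≡ z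
↥-toℚ z = begin
  ↥ (toℚ z)               ≡⟨ ℤP.*-identityʳ _ ⟨
  ↥ (toℚ z) * + 1         ≡⟨ cong (↥ (toℚ z) *_) (gcd-zeroʳ z) ⟨
  ↥ (toℚ z) * gcd z (+ 1) ≡⟨ ℚP.↥-/ z 1 ⟩
  z                       ∎
  where open ≡-Reasoning

↧-toℚ : ∀ z → ↧ (toℚ z) ≡ + 1
↧-toℚ z = begin
  ↧ (toℚ z)               ≡⟨ ℤP.*-identityʳ _ ⟨
  ↧ (toℚ z) * + 1         ≡⟨ cong (↧ (toℚ z) *_) (gcd-zeroʳ z) ⟨
  ↧ (toℚ z) * gcd z (+ 1) ≡⟨ ℚP.↧-/ z 1 ⟩
  + 1                     ∎
  where open ≡-Reasoning

toℚ-cancel-≤ : ∀ {i j} → toℚ i ℚ.≤ toℚ j → i ≤ j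
toℚ-cancel-≤ {i} {j} i≤j = subst₂ _≤_ (side i j) (side j i) (ℚP.drop-*≤* i≤j)
  where
  side : ∀ a b → ↥ (toℚ a) * ↧ (toℚ b) ≡ a
  side a b = trans (cong₂ _*_ (↥-toℚ a) (↧-toℚ b)) (ℤP.*-identityʳ a)

toℚ-b2z : ∀ β → toℚ (b2z β) ≡ 0ℚ ⊎ toℚ (b2z β) ≡ 1ℚ
toℚ-b2z false = inj₁ refl
toℚ-b2z true  = inj₂ refl

unit-interval-bit : ∀ z → + 0 ≤ z → z ≤ + 1 → ∃ λ β → z ≡ b2z β
unit-interval-bit (+ 0)           _  _                    = false , refl
unit-interval-bit (+ 1)           _  _                    = true , refl
unit-interval-bit (+ suc (suc n)) _  (+≤+ (ℕ.s≤s ()))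
unit-interval-bit -[1+ n ]        () _

cutPolytope-bits : ∀ {x} → InCutPolytope x → ∀ e → ∃ λ β → lookup x e ≡ b2z β
cutPolytope-bits {x} (λc , λc≥0 , Σλc≡1 , x≡) e
  with bit-weighted-sum-bounds λc (λ S → toℚ (lookup (δ S) e)) λc≥0 δₑ-bit (allSubsets 5)
  where
  δₑ-bit : ∀ S → toℚ (lookup (δ S) e) ≡ 0ℚ ⊎ toℚ (lookup (δ S) e) ≡ 1ℚ
  δₑ-bit S rewrite lookup-δ S e = toℚ-b2z (cuts S e)
... | lo , hi = unit-interval-bit (lookup x e)
  (toℚ-cancel-≤ (subst (0ℚ ℚ.≤_) (sym (x≡ e)) lo))
  (toℚ-cancel-≤ (subst₂ ℚ._≤_ (sym (x≡ e)) Σλc≡1 hi))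

sumℤ-+ : ∀ {A : Set} (f g : A → ℤ) as →
  sumℤ (L.map f as) + sumℤ (L.map g as) ≡ sumℤ (L.map (λ a → f a + g a) as)
sumℤ-+ f g []       = refl
sumℤ-+ f g (a ∷ as) = begin
  (f a + F) + (g a + G)
    ≡⟨ solve 4 (λ x y X Y → (x :+ X) :+ (y :+ Y) := (x :+ y) :+ (X :+ Y)) refl (f a) (g a) F G ⟩
  (f a + g a) + (F + G)
    ≡⟨ cong (_+_ (f a + g a)) (sumℤ-+ f g as) ⟩
  (f a + g a) + sumℤ (L.map (λ a → f a + g a) as) ∎
  where
  open ≡-Reasoning
  F = sumℤ (L.map f as)
  G = sumℤ (L.map g as)

∣-sumℤ : ∀ {A : Set} {k} (f : A → ℤ) → (∀ a → k ∣ f a) → ∀ as → k ∣ sumℤ (L.map f as)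
∣-sumℤ f k∣f []       = divides (+ 0) refl
∣-sumℤ f k∣f (a ∷ as) = ∣m∣n⇒∣m+n (k∣f a) (∣-sumℤ f k∣f as)

triangleSum : Fin 10 → Fin 10 → Fin 10 → Pt → ℤ
triangleSum e₁ e₂ e₃ x = lookup x e₁ + lookup x e₂ + lookup x e₃

lattice-triangleSum-even : ∀ e₁ e₂ e₃ → (∀ S → + 2 ∣ triangleSum e₁ e₂ e₃ (δ S)) →
  ∀ {x} → InLattice x → + 2 ∣ triangleSum e₁ e₂ e₃ x
lattice-triangleSum-even e₁ e₂ e₃ δ-even {x} (a , x≡) =
  subst (+ 2 ∣_) (sym expansion) (∣-sumℤ _ (λ S → ∣n⇒∣m*n (a S) (δ-even S)) (allSubsets 5))
  where
  term : Fin 10 → VSubset → ℤ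
  term e S = a S * lookup (δ S) e
  coordinate : ∀ e → lookup x e ≡ sumℤ (L.map (term e) (allSubsets 5))
  coordinate e = trans (cong (λ v → lookup v e) x≡)
                       (VP.lookup∘tabulate (λ e → sumℤ (L.map (term e) (allSubsets 5))) e)
  expansion : triangleSum e₁ e₂ e₃ x ≡ sumℤ (L.map (λ S → a S * triangleSum e₁ e₂ e₃ (δ S)) (allSubsets 5))
  expansion = trans (cong₂ _+_ (cong₂ _+_ (coordinate e₁) (coordinate e₂)) (coordinate e₃))
                    (regroup (allSubsets 5))
    where
    open ≡-Reasoning
    distrib : ∀ S → term e₁ S + term e₂ S + term e₃ S ≡ a S * triangleSum e₁ e₂ e₃ (δ S)
    distrib S = solve 4 (λ a x y z → a :* x :+ a :* y :+ a :* z := a :* (x :+ y :+ z))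
      refl (a S) (lookup (δ S) e₁) (lookup (δ S) e₂) (lookup (δ S) e₃)
    regroup : ∀ Ss → sumℤ (L.map (term e₁) Ss) + sumℤ (L.map (term e₂) Ss) + sumℤ (L.map (term e₃) Ss)
                   ≡ sumℤ (L.map (λ S → a S * triangleSum e₁ e₂ e₃ (δ S)) Ss)
    regroup Ss = begin
      sumℤ (L.map (term e₁) Ss) + sumℤ (L.map (term e₂) Ss) + sumℤ (L.map (term e₃) Ss)
        ≡⟨ cong₂ _+_ (sumℤ-+ (term e₁) (term e₂) Ss) refl ⟩
      sumℤ (L.map (λ S → term e₁ S + term e₂ S) Ss) + sumℤ (L.map (term e₃) Ss)
        ≡⟨ sumℤ-+ _ (term e₃) Ss ⟩
      sumℤ (L.map (λ S → term e₁ S + term e₂ S + term e₃ S) Ss)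
        ≡⟨ cong sumℤ (LP.map-cong distrib Ss) ⟩
      sumℤ (L.map (λ S → a S * triangleSum e₁ e₂ e₃ (δ S)) Ss) ∎

cut-triangle-even : ∀ p q r → + 2 ∣ b2z (p xor q) + b2z (p xor r) + b2z (q xor r)
cut-triangle-even true  true  true  = divides (+ 0) refl
cut-triangle-even true  true  false = divides (+ 1) refl
cut-triangle-even true  false true  = divides (+ 1) refl
cut-triangle-even true  false false = divides (+ 1) refl
cut-triangle-even false true  true  = divides (+ 1) refl
cut-triangle-even false true  false = divides (+ 1) refl
cut-triangle-even false false true  = divides (+ 1) refl
cut-triangle-even false false false = divides (+ 0) refl

odd-≢-even : ∀ n k → + suc (2 ℕ.* n) ≢ k * + 2
odd-≢-even n k odd≡even = ℕP.even≢odd ∣ k ∣ n (begin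
  2 ℕ.* ∣ k ∣   ≡⟨ ℕP.*-comm 2 ∣ k ∣ ⟩
  ∣ k ∣ ℕ.* 2   ≡⟨ ℤP.abs-* k (+ 2) ⟨
  ∣ k * + 2 ∣   ≡⟨ cong ∣_∣ odd≡even ⟨
  suc (2 ℕ.* n) ∎)
  where open ≡-Reasoning

even-triangle-xor : ∀ p q r → + 2 ∣ b2z p + b2z q + b2z r → r ≡ p xor q
even-triangle-xor true  true  false _ = refl
even-triangle-xor true  false true  _ = refl
even-triangle-xor false true  true  _ = refl
even-triangle-xor false false false _ = refl
even-triangle-xor true  true  true  (divides k 3≡2k) = ⊥-elim (odd-≢-even 1 k 3≡2k)
even-triangle-xor true  false false (divides k 1≡2k) = ⊥-elim (odd-≢-even 0 k 1≡2k)
even-triangle-xor false true  false (divides k 1≡2k) = ⊥-elim (odd-≢-even 0 k 1≡2k)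
even-triangle-xor false false true  (divides k 1≡2k) = ⊥-elim (odd-≢-even 0 k 1≡2k)

bitsAtVertex0 : Vec Bool 10 → Vec Bool 4
bitsAtVertex0 β = lookup β (# 0) ∷ lookup β (# 1) ∷ lookup β (# 2) ∷ lookup β (# 3) ∷ []

cut-from-vertex0 : ∀ {b₁ b₂ b₃ b₄ b₁₂ b₁₃ b₁₄ b₂₃ b₂₄ b₃₄} →
  b₁₂ ≡ b₁ xor b₂ → b₁₃ ≡ b₁ xor b₃ → b₁₄ ≡ b₁ xor b₄ → b₂₃ ≡ b₂ xor b₃ → b₂₄ ≡ b₂ xor b₄ → b₃₄ ≡ b₃ xor b₄ →
  V.map b2z (b₁ ∷ b₂ ∷ b₃ ∷ b₄ ∷ b₁₂ ∷ b₁₃ ∷ b₁₄ ∷ b₂₃ ∷ b₂₄ ∷ b₃₄ ∷ []) ≡ δ (false ∷ b₁ ∷ b₂ ∷ b₃ ∷ b₄ ∷ [])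
cut-from-vertex0 refl refl refl refl refl refl = refl

lattice-bits-are-cut : ∀ (β : Vec Bool 10) → InLattice (V.map b2z β) →
  V.map b2z β ≡ δ (false ∷ bitsAtVertex0 β)
lattice-bits-are-cut β@(b₁ ∷ b₂ ∷ b₃ ∷ b₄ ∷ b₁₂ ∷ b₁₃ ∷ b₁₄ ∷ b₂₃ ∷ b₂₄ ∷ b₃₄ ∷ []) lat = cut-from-vertex0
  (even-triangle-xor b₁ b₂ b₁₂ (triangle (# 0) (# 1) (# 4)
    λ where (s₀ ∷ s₁ ∷ s₂ ∷ _) → cut-triangle-even s₀ s₁ s₂))
  (even-triangle-xor b₁ b₃ b₁₃ (triangle (# 0) (# 2) (# 5)
    λ where (s₀ ∷ s₁ ∷ _ ∷ s₃ ∷ _) → cut-triangle-even s₀ s₁ s₃))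
  (even-triangle-xor b₁ b₄ b₁₄ (triangle (# 0) (# 3) (# 6)
    λ where (s₀ ∷ s₁ ∷ _ ∷ _ ∷ s₄ ∷ _) → cut-triangle-even s₀ s₁ s₄))
  (even-triangle-xor b₂ b₃ b₂₃ (triangle (# 1) (# 2) (# 7)
    λ where (s₀ ∷ _ ∷ s₂ ∷ s₃ ∷ _) → cut-triangle-even s₀ s₂ s₃))
  (even-triangle-xor b₂ b₄ b₂₄ (triangle (# 1) (# 3) (# 8)
    λ where (s₀ ∷ _ ∷ s₂ ∷ _ ∷ s₄ ∷ _) → cut-triangle-even s₀ s₂ s₄))
  (even-triangle-xor b₃ b₄ b₃₄ (triangle (# 2) (# 3) (# 9)
    λ where (s₀ ∷ _ ∷ _ ∷ s₃ ∷ s₄ ∷ _) → cut-triangle-even s₀ s₃ s₄))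
  where
  triangle : ∀ e₁ e₂ e₃ → (∀ S → + 2 ∣ triangleSum e₁ e₂ e₃ (δ S)) →
    + 2 ∣ triangleSum e₁ e₂ e₃ (V.map b2z β)
  triangle e₁ e₂ e₃ δ-even = lattice-triangleSum-even e₁ e₂ e₃ δ-even lat

cutVectors : List Pt
cutVectors = L.map (δ ∘ (false ∷_)) (allSubsets 4)

_≟ₚ_ : (x y : Pt) → Dec (x ≡ y)
_≟ₚ_ = VP.≡-dec ℤ._≟_

open DecMembership _≟ₚ_ using (_∈?_)
open import Data.List.Relation.Unary.Unique.DecPropositional _≟ₚ_ using (unique?)

latticePt⇒cutVector : ∀ {x} → LatticePt x → x ∈ cutVectors
latticePt⇒cutVector {x} (lat , pol) =
  subst (_∈ cutVectors) (sym x≡cut) (∈-map⁺ (δ ∘ (false ∷_)) (allSubsets-complete 4 (bitsAtVertex0 β)))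
  where
  β : Vec Bool 10
  β = tabulate (proj₁ ∘ cutPolytope-bits {x} pol)
  x≡bits : x ≡ V.map b2z β
  x≡bits = trans (sym (VP.tabulate∘lookup x))
    (trans (VP.tabulate-cong (proj₂ ∘ cutPolytope-bits {x} pol))
           (VP.tabulate-∘ b2z (proj₁ ∘ cutPolytope-bits {x} pol)))
  x≡cut : x ≡ δ (false ∷ bitsAtVertex0 β)
  x≡cut = trans x≡bits (lattice-bits-are-cut β (subst InLattice x≡bits lat))

_≟ₛ_ : ∀ {n} → (S T : Vec Bool n) → Dec (S ≡ T)
_≟ₛ_ = VP.≡-dec Bool._≟_

dirac : ∀ {A : Set} → A → A → VSubset → VSubset → A
dirac one nil S T = if ⌊ T ≟ₛ S ⌋ then one else nil

dirac-nonNegative : ∀ S T → 0ℚ ℚ.≤ dirac 1ℚ 0ℚ S T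
dirac-nonNegative S T with ⌊ T ≟ₛ S ⌋
... | true  = ℚP.nonNegative⁻¹ 1ℚ
... | false = ℚP.≤-refl

DiracRepresents : VSubset → Set
DiracRepresents S =
    δ S ≡ tabulate (λ e → sumℤ (L.map (λ T → dirac (+ 1) (+ 0) S T * lookup (δ T) e) (allSubsets 5)))
  × sumℚ (L.map (dirac 1ℚ 0ℚ S) (allSubsets 5)) ≡ 1ℚ
  × tabulate (λ e → toℚ (lookup (δ S) e))
      ≡ tabulate (λ e → sumℚ (L.map (λ T → dirac 1ℚ 0ℚ S T ℚ.* toℚ (lookup (δ T) e)) (allSubsets 5)))

diracRepresents? : ∀ S → Dec (DiracRepresents S)
diracRepresents? S = VP.≡-dec ℤ._≟_ _ _ ×-dec (_ ℚP.≟ _ ×-dec VP.≡-dec ℚP._≟_ _ _)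

tabulate-injective : ∀ {A : Set} {n} {f g : Fin n → A} → tabulate f ≡ tabulate g → ∀ i → f i ≡ g i
tabulate-injective {f = f} {g} eq i =
  trans (sym (VP.lookup∘tabulate f i)) (trans (cong (λ v → lookup v i) eq) (VP.lookup∘tabulate g i))

dirac-represents : All DiracRepresents (allSubsets 5)
dirac-represents = from-yes (All.all? diracRepresents? (allSubsets 5))

δ-latticePt : ∀ S → LatticePt (δ S)
δ-latticePt S =
  (dirac (+ 1) (+ 0) S , proj₁ rep) ,
  (dirac 1ℚ 0ℚ S , dirac-nonNegative S , proj₁ (proj₂ rep) , tabulate-injective (proj₂ (proj₂ rep)))
  where
  rep : DiracRepresents S
  rep = All.lookup dirac-represents (allSubsets-complete 5 S)

latticePt⇔cutVector : ∀ x → LatticePt x ⇔ x ∈ cutVectors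
latticePt⇔cutVector x = mk⇔ latticePt⇒cutVector cutVector⇒latticePt
  where
  cutVector⇒latticePt : x ∈ cutVectors → LatticePt x
  cutVector⇒latticePt x∈ with ∈-map⁻ (δ ∘ (false ∷_)) {xs = allSubsets 4} x∈
  ... | S , _ , refl = δ-latticePt (false ∷ S)

latticePts-satisfy : ∀ {P : Pt → Set} → All P cutVectors → ∀ {x} → LatticePt x → P x
latticePts-satisfy all-P x-lat = All.lookup all-P (latticePt⇒cutVector x-lat)

innerProduct : ∀ {n} → Vec ℤ n → Vec ℤ n → ℤ
innerProduct c x = V.foldr (λ _ → ℤ) _+_ (+ 0) (V.zipWith _*_ c x)

innerProduct-zeroʳ : ∀ {n} (c : Vec ℤ n) → innerProduct c (V.replicate n (+ 0)) ≡ + 0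
innerProduct-zeroʳ []       = refl
innerProduct-zeroʳ (c ∷ cs) rewrite innerProduct-zeroʳ cs = trans (ℤP.+-identityʳ _) (ℤP.*-zeroʳ c)

innerProduct-+ʳ : ∀ {n} (c u v : Vec ℤ n) →
  innerProduct c (V.zipWith _+_ u v) ≡ innerProduct c u + innerProduct c v
innerProduct-+ʳ []       []       []       = refl
innerProduct-+ʳ (c ∷ cs) (u ∷ us) (v ∷ vs) rewrite innerProduct-+ʳ cs us vs =
  solve 5 (λ c u v U W → c :* (u :+ v) :+ (U :+ W) := (c :* u :+ U) :+ (c :* v :+ W))
    refl c u v (innerProduct cs us) (innerProduct cs vs)

innerProduct-*ʳ : ∀ {n} (c u : Vec ℤ n) a → innerProduct c (V.map (a *_) u) ≡ a * innerProduct c u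
innerProduct-*ʳ []       []       a = sym (ℤP.*-zeroʳ a)
innerProduct-*ʳ (c ∷ cs) (u ∷ us) a rewrite innerProduct-*ʳ cs us a =
  solve 4 (λ c u a U → c :* (a :* u) :+ a :* U := a :* (c :* u :+ U)) refl c u a (innerProduct cs us)

linComb : ∀ {n} → List (ℤ × Vec ℤ n) → Vec ℤ n
linComb []             = V.replicate _ (+ 0)
linComb ((a , p) ∷ ts) = V.zipWith _+_ (V.map (a *_) p) (linComb ts)

innerProduct-linComb : ∀ {n} (c : Vec ℤ n) b ts → All (λ t → innerProduct c (proj₂ t) ≡ b) ts →
  innerProduct c (linComb ts) ≡ sumℤ (L.map proj₁ ts) * b
innerProduct-linComb c b []             []             = trans (innerProduct-zeroʳ c) (sym (ℤP.*-zeroˡ b))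
innerProduct-linComb c b ((a , p) ∷ ts) (cp≡b ∷ cts≡b) = begin
  innerProduct c (V.zipWith _+_ (V.map (a *_) p) (linComb ts))
    ≡⟨ innerProduct-+ʳ c _ _ ⟩
  innerProduct c (V.map (a *_) p) + innerProduct c (linComb ts)
    ≡⟨ cong₂ _+_ (trans (innerProduct-*ʳ c p a) (cong (a *_) cp≡b)) (innerProduct-linComb c b ts cts≡b) ⟩
  a * b + sumℤ (L.map proj₁ ts) * b
    ≡⟨ ℤP.*-distribʳ-+ b a _ ⟨
  (a + sumℤ (L.map proj₁ ts)) * b ∎
  where open ≡-Reasoning

Hyperplane : Pt → ℤ → PtSet
Hyperplane c b x = dot c x ≡ b

-- (1 + scale)·x = v + Σ wᵢ·psᵢ with Σ wᵢ = scale: as x and v both occur with nonzero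
-- coefficient, a hyperplane through all of ps contains x if and only if it contains v.
record AffineRelation (ps : List Pt) (v x : Pt) : Set where
  constructor affineRelation
  field
    scale       : ℕ
    weights     : List ℤ
    weights-sum : sumℤ (L.map proj₁ (L.zip weights ps)) ≡ + scale
    relation    : V.map (+ suc scale *_) x ≡ V.zipWith _+_ v (linComb (L.zip weights ps))

module _ {ps v x} (r : AffineRelation ps v x) {c b} (ps⊆H : All (Hyperplane c b) ps) where
  open AffineRelation r

  affineRelation-balance : + suc scale * dot c x ≡ dot c v + + scale * b
  affineRelation-balance = begin
    + suc scale * dot c x                                 ≡⟨ innerProduct-*ʳ c x (+ suc scale) ⟨
    dot c (V.map (+ suc scale *_) x)                      ≡⟨ cong (dot c) relation ⟩
    dot c (V.zipWith _+_ v (linComb (L.zip weights ps)))  ≡⟨ innerProduct-+ʳ c v _ ⟩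
    dot c v + dot c (linComb (L.zip weights ps))
      ≡⟨ cong (_+_ (dot c v)) (innerProduct-linComb c b _ (zip-on weights ps⊆H)) ⟩
    dot c v + sumℤ (L.map proj₁ (L.zip weights ps)) * b   ≡⟨ cong (λ s → dot c v + s * b) weights-sum ⟩
    dot c v + + scale * b                                 ∎
    where
    open ≡-Reasoning
    zip-on : ∀ ws {qs} → All (Hyperplane c b) qs → All (λ t → dot c (proj₂ t) ≡ b) (L.zip ws qs)
    zip-on []       _            = []
    zip-on (_ ∷ _)  []           = []
    zip-on (_ ∷ ws) (cq≡b ∷ cqs) = cq≡b ∷ zip-on ws cqs

  hyperplane-fromBase : Hyperplane c b v → Hyperplane c b x
  hyperplane-fromBase cv≡b = ℤP.*-cancelˡ-≡ (+ suc scale) _ _ (begin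
    + suc scale * dot c x   ≡⟨ affineRelation-balance ⟩
    dot c v + + scale * b   ≡⟨ cong (λ s → s + + scale * b) cv≡b ⟩
    b + + scale * b         ≡⟨ solve 2 (λ k b → b :+ k :* b := (con (+ 1) :+ k) :* b) refl (+ scale) b ⟩
    + suc scale * b         ∎)
    where open ≡-Reasoning

  hyperplane-toBase : Hyperplane c b x → Hyperplane c b v
  hyperplane-toBase cx≡b = +-cancelʳ (+ scale * b) (dot c v) b (begin
    dot c v + + scale * b   ≡⟨ affineRelation-balance ⟨
    + suc scale * dot c x   ≡⟨ cong (+ suc scale *_) cx≡b ⟩
    + suc scale * b         ≡⟨ solve 2 (λ k b → (con (+ 1) :+ k) :* b := b :+ k :* b) refl (+ scale) b ⟩
    b + + scale * b         ∎)
    where open ≡-Reasoning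

-- Faces, facets and pulling along a flag

face : Pt → ℤ → PtSet
face c b x = LatticePt x × Hyperplane c b x

face-isFace : ∀ c b → (∀ S → dot c (δ S) ≤ b) → IsFace (face c b)
face-isFace c b valid = c , b , valid , λ _ → mk⇔ id id

facet-missing-one-point : ∀ {F Q v} → IsFace F → F ⊆ₚ Q → Q v → ¬ F v →
  (∀ x → Q x → F x ⊎ x ≡ v) → IsFacetOf F Q
facet-missing-one-point {F} {Q} {v} F-face F⊆Q Qv ¬Fv Q⊆F∪v = F-face , (F⊆Q , v , Qv , ¬Fv) , maximal
  where
  maximal : ∀ G → IsFace G → F ⊊ₚ G → G ⊆ₚ Q → Q ⊆ₚ G
  maximal G _ (F⊆G , y , Gy , ¬Fy) G⊆Q x Qx with Q⊆F∪v x Qx | Q⊆F∪v y (G⊆Q y Gy)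
  ... | inj₁ Fx   | _         = F⊆G x Fx
  ... | inj₂ refl | inj₁ Fy   = ⊥-elim (¬Fy Fy)
  ... | inj₂ refl | inj₂ refl = Gy

facet-by-affine-relations : ∀ {F Q v} ps → IsFace F → F ⊆ₚ Q → Q ⊆ₚ LatticePt → Q v → ¬ F v →
  All F ps → (∀ x → Q x → F x ⊎ AffineRelation ps v x) → IsFacetOf F Q
facet-by-affine-relations {F} {Q} {v} ps F-face F⊆Q Q⊆L Qv ¬Fv ps⊆F tied =
  F-face , (F⊆Q , v , Qv , ¬Fv) , maximal
  where
  maximal : ∀ G → IsFace G → F ⊊ₚ G → G ⊆ₚ Q → Q ⊆ₚ G
  maximal G (c , b , _ , G⇔) (F⊆G , y , Gy , ¬Fy) G⊆Q = Q⊆G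
    where
    G⊆H : ∀ {z} → G z → Hyperplane c b z
    G⊆H {z} Gz = proj₂ (Equivalence.to (G⇔ z) Gz)
    ps⊆H : All (Hyperplane c b) ps
    ps⊆H = All.map (λ Fp → G⊆H (F⊆G _ Fp)) ps⊆F
    v∈H : Hyperplane c b v
    v∈H with tied y (G⊆Q y Gy)
    ... | inj₁ Fy = ⊥-elim (¬Fy Fy)
    ... | inj₂ r  = hyperplane-toBase r {c} {b} ps⊆H (G⊆H Gy)
    Q⊆G : Q ⊆ₚ G
    Q⊆G x Qx with tied x Qx
    ... | inj₁ Fx = F⊆G x Fx
    ... | inj₂ r  = Equivalence.from (G⇔ x) (Q⊆L x Qx , hyperplane-fromBase r {c} {b} ps⊆H v∈H)

-- Pulling the points vs in turn from the face c · x = b, none of whose lattice points lies in pre,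
-- passes through the faces hs, each a facet of the previous one missing exactly the point just
-- pulled; the last face is empty.
PullingFlag : List Pt → Pt → ℤ → List Pt → List (Pt × ℤ) → Set
PullingFlag pre c b []       []               = All (λ x → dot c x ≢ b) cutVectors
PullingFlag pre c b (v ∷ vs) ((c′ , b′) ∷ hs) =
    All (λ x → dot c x ≢ b) pre
  × v ∈ cutVectors × dot c v ≡ b × dot c′ v ≢ b′
  × All (λ S → dot c′ (δ S) ≤ b′) (allSubsets 5)
  × All (λ x → (dot c′ x ≡ b′ → dot c x ≡ b) × (dot c x ≡ b → dot c′ x ≡ b′ ⊎ x ≡ v)) cutVectors
  × PullingFlag (pre ++ L.[ v ]) c′ b′ vs hs
PullingFlag _ _ _ _ _ = ⊥

pullingFlag? : ∀ pre c b vs hs → Dec (PullingFlag pre c b vs hs)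
pullingFlag? pre c b [] [] = All.all? (λ x → ¬? (dot c x ℤ.≟ b)) cutVectors
pullingFlag? pre c b (v ∷ vs) ((c′ , b′) ∷ hs) =
        All.all? (λ x → ¬? (dot c x ℤ.≟ b)) pre
  ×-dec v ∈? cutVectors ×-dec dot c v ℤ.≟ b ×-dec ¬? (dot c′ v ℤ.≟ b′)
  ×-dec All.all? (λ S → dot c′ (δ S) ℤ.≤? b′) (allSubsets 5)
  ×-dec All.all? (λ x → ((dot c′ x ℤ.≟ b′) →-dec (dot c x ℤ.≟ b))
                  ×-dec ((dot c x ℤ.≟ b) →-dec ((dot c′ x ℤ.≟ b′) ⊎-dec (x ≟ₚ v)))) cutVectors
  ×-dec pullingFlag? (pre ++ L.[ v ]) c′ b′ vs hs
pullingFlag? _ _ _ []      (_ ∷ _) = no id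
pullingFlag? _ _ _ (_ ∷ _) []      = no id

module _ {ord : List Pt} where

  pulling-cone : ∀ {Q F v vs} → FirstIn ord Q v → IsFacetOf F Q → ¬ F v →
    Pulling ord F (_∈ vs) → Pulling ord Q (_∈ v ∷ vs)
  pulling-cone {F = F} {v} {vs} first facet ¬Fv pull =
    cone v F (_∈ vs) first facet ¬Fv pull (λ x → ⇔-sym (↔⇒⇔ (∷↔ (x ≡_))))

  pulling-along-flag : ∀ pre c b vs hs post → ord ≡ pre ++ vs ++ post →
    PullingFlag pre c b vs hs → Pulling ord (face c b) (_∈ vs)
  pulling-along-flag pre c b [] [] post _ empty-face =
    empty (λ x Fx → latticePts-satisfy empty-face (proj₁ Fx) (proj₂ Fx)) (λ _ ())
  pulling-along-flag pre c b (v ∷ vs) ((c′ , b′) ∷ hs) post ord≡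
    (pre∉Q , v-cut , v∈Q , v∉F , valid , nested , flag) =
    pulling-cone first facet (v∉F ∘ proj₂)
      (pulling-along-flag (pre ++ L.[ v ]) c′ b′ vs hs post ord≡′ flag)
    where
    v-lattice : LatticePt v
    v-lattice = Equivalence.from (latticePt⇔cutVector v) v-cut
    first : FirstIn ord (face c b) v
    first = pre , vs ++ post , ord≡ , (v-lattice , v∈Q) , All.map (_∘ proj₂) pre∉Q
    ord≡′ : ord ≡ (pre ++ L.[ v ]) ++ vs ++ post
    ord≡′ = trans ord≡ (sym (LP.++-assoc pre L.[ v ] (vs ++ post)))
    facet : IsFacetOf (face c′ b′) (face c b)
    facet = facet-missing-one-point
      (face-isFace c′ b′ (λ S → All.lookup valid (allSubsets-complete 5 S)))
      (λ x (x-lat , x∈F) → x-lat , proj₁ (latticePts-satisfy nested x-lat) x∈F)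
      (v-lattice , v∈Q) (v∉F ∘ proj₂)
      (λ x (x-lat , x∈Q) → Sum.map₁ (x-lat ,_) (proj₂ (latticePts-satisfy nested x-lat) x∈Q))

infixl 7 _*₀_

_*₀_ : ℤ → ℤ → ℤ
+ 0 *₀ _ = + 0
i   *₀ j = i * j

*₀≡* : ∀ i j → i *₀ j ≡ i * j
*₀≡* (+ 0)     j = refl
*₀≡* +[1+ n ]  j = refl
*₀≡* -[1+ n ]  j = refl

-- `det` with the minors of zero entries skipped, which makes it feasible to evaluate.
det₀ : ∀ {n} → Vec (Vec ℤ n) n → ℤ
det₀ {zero}  []       = + 1
det₀ {suc n} (r ∷ rs) = V.foldr (λ _ → ℤ) _+_ (+ 0)
  (tabulate λ j → (sign (Fin.toℕ j) * lookup r j) *₀ det₀ (V.map (λ row → V.removeAt row j) rs))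

det≡det₀ : ∀ {n} (M : Vec (Vec ℤ n) n) → det M ≡ det₀ M
det≡det₀ {zero}  []       = refl
det≡det₀ {suc n} (r ∷ rs) = cong (V.foldr (λ _ → ℤ) _+_ (+ 0)) (VP.tabulate-cong λ j →
  trans (cong (sign (Fin.toℕ j) * lookup r j *_) (det≡det₀ (V.map (λ row → V.removeAt row j) rs)))
        (sym (*₀≡* (sign (Fin.toℕ j) * lookup r j) (det₀ (V.map (λ row → V.removeAt row j) rs)))))

vol≡∣det₀∣ : ∀ vs → vol vs ≡ ∣ det₀ (V.map (λ v → V.zipWith ℤ._-_ v (V.head vs)) (V.tail vs)) ∣
vol≡∣det₀∣ (v₀ ∷ vs) = cong ∣_∣ (det≡det₀ (V.map (λ v → V.zipWith ℤ._-_ v v₀) vs))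

-- A pulling triangulation with a non-unimodular simplex

-- Overloaded literals for Fin 5 and ℤ are confined to this block: they would confuse the ring solver.
module _ where
  open import Agda.Builtin.FromNat using (Number; fromNat)
  open import Agda.Builtin.FromNeg using (Negative; fromNeg)
  import Data.Nat.Literals as ℕLiterals
  import Data.Fin.Literals as FinLiterals
  import Data.Integer.Literals as ℤLiterals
  open import Data.Unit using (⊤; tt)

  instance
    ℕ-literals : Number ℕ
    ℕ-literals = ℕLiterals.number
    Fin-literals : ∀ {n} → Number (Fin n)
    Fin-literals {n} = FinLiterals.number n
    ℤ-literals : Number ℤ
    ℤ-literals = ℤLiterals.number
    ℤ-negative-literals : Negative ℤ
    ℤ-negative-literals = ℤLiterals.negative
    literal-constraint : ⊤
    literal-constraint = tt

  subset : List (Fin 5) → VSubset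
  subset is = tabulate λ i → any (λ j → ⌊ i Fin.≟ j ⌋) is

  δ⟨_⟩ : List (Fin 5) → Pt
  δ⟨ is ⟩ = δ (subset is)

  apex : Pt
  apex = δ⟨ 3 ∷ 4 ∷ [] ⟩

  simplex : List Pt
  simplex = apex ∷ δ⟨ 1 ∷ 2 ∷ 3 ∷ 4 ∷ [] ⟩ ∷ δ⟨ 1 ∷ 2 ∷ 3 ∷ [] ⟩ ∷ δ⟨ 1 ∷ 2 ∷ 4 ∷ [] ⟩
          ∷ δ⟨ 1 ∷ 3 ∷ [] ⟩ ∷ δ⟨ 1 ∷ 4 ∷ [] ⟩ ∷ δ⟨ 1 ∷ [] ⟩ ∷ δ⟨ 2 ∷ 3 ∷ [] ⟩ ∷ δ⟨ 2 ∷ 4 ∷ [] ⟩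
          ∷ δ⟨ 2 ∷ [] ⟩ ∷ δ⟨ [] ⟩ ∷ []

  others : List Pt
  others = δ⟨ 1 ∷ 2 ∷ [] ⟩ ∷ δ⟨ 1 ∷ 3 ∷ 4 ∷ [] ⟩ ∷ δ⟨ 2 ∷ 3 ∷ 4 ∷ [] ⟩ ∷ δ⟨ 3 ∷ [] ⟩ ∷ δ⟨ 4 ∷ [] ⟩ ∷ []

  ordering : List Pt
  ordering = simplex ++ others

  -- The pentagonal inequality Σ bᵢ bⱼ xᵢⱼ ≤ 0 for b = (1, 1, 1, -1, -1).
  pentagonal : Pt
  pentagonal = 1 ∷ 1 ∷ -1 ∷ -1 ∷ 1 ∷ -1 ∷ -1 ∷ -1 ∷ -1 ∷ 1 ∷ []

  flag : List (Pt × ℤ)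
  flag = ( 1 ∷  1 ∷ -2 ∷ -2 ∷ 1 ∷ -1 ∷ -1 ∷ -1 ∷ -1 ∷  2 ∷ [] , 0)
       ∷ ( 1 ∷  1 ∷ -2 ∷ -2 ∷ 2 ∷ -1 ∷ -2 ∷ -1 ∷ -2 ∷  2 ∷ [] , 0)
       ∷ ( 0 ∷  0 ∷ -2 ∷ -2 ∷ 4 ∷ -2 ∷ -2 ∷ -2 ∷ -2 ∷  2 ∷ [] , 0)
       ∷ (-1 ∷  1 ∷ -4 ∷ -2 ∷ 4 ∷ -1 ∷ -2 ∷ -3 ∷ -2 ∷  2 ∷ [] , 0)
       ∷ (-2 ∷  2 ∷ -4 ∷ -4 ∷ 4 ∷ -1 ∷ -1 ∷ -3 ∷ -3 ∷  2 ∷ [] , 0)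
       ∷ (-5 ∷  3 ∷ -3 ∷ -3 ∷ 3 ∷ -3 ∷ -3 ∷ -3 ∷ -3 ∷  3 ∷ [] , 0)
       ∷ (-6 ∷  2 ∷ -6 ∷ -2 ∷ 2 ∷ -6 ∷ -2 ∷  2 ∷ -6 ∷ -2 ∷ [] , 0)
       ∷ (-6 ∷  0 ∷ -6 ∷ -6 ∷ 0 ∷ -6 ∷ -6 ∷  0 ∷  0 ∷ -6 ∷ [] , 0)
       ∷ (-5 ∷ -5 ∷ -5 ∷ -5 ∷ -5 ∷ -5 ∷ -5 ∷ -5 ∷ -5 ∷ -5 ∷ [] , 0)
       ∷ (V.replicate 10 0 , 1)
       ∷ []

  pentagonal-flag : PullingFlag L.[ apex ] pentagonal 0 (L.drop 1 simplex) flag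
  pentagonal-flag = from-yes (pullingFlag? L.[ apex ] pentagonal 0 (L.drop 1 simplex) flag)

  offPentagonal : List Pt
  offPentagonal = δ⟨ 4 ∷ [] ⟩ ∷ δ⟨ 3 ∷ [] ⟩ ∷ apex ∷ δ⟨ 2 ∷ 3 ∷ 4 ∷ [] ⟩ ∷ δ⟨ 1 ∷ 3 ∷ 4 ∷ [] ⟩ ∷ δ⟨ 1 ∷ 2 ∷ [] ⟩ ∷ []

  tied-to-apex : All (AffineRelation (L.drop 1 simplex) apex) offPentagonal
  tied-to-apex = affineRelation 2 (-1 ∷  2 ∷ -1 ∷ -1 ∷  2 ∷ -1 ∷ -1 ∷  2 ∷ -1 ∷  2 ∷ []) refl refl
               ∷ affineRelation 2 (-1 ∷ -1 ∷  2 ∷  2 ∷ -1 ∷ -1 ∷  2 ∷ -1 ∷ -1 ∷  2 ∷ []) refl refl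
               ∷ affineRelation 0 [] refl refl
               ∷ affineRelation 2 ( 2 ∷ -1 ∷ -1 ∷ -1 ∷ -1 ∷  2 ∷  2 ∷  2 ∷ -1 ∷ -1 ∷ []) refl refl
               ∷ affineRelation 2 ( 2 ∷ -1 ∷ -1 ∷  2 ∷  2 ∷ -1 ∷ -1 ∷ -1 ∷  2 ∷ -1 ∷ []) refl refl
               ∷ affineRelation 2 (-1 ∷  2 ∷  2 ∷ -1 ∷ -1 ∷  2 ∷ -1 ∷ -1 ∷  2 ∷ -1 ∷ []) refl refl
               ∷ []

  apex-lattice : LatticePt apex
  apex-lattice = δ-latticePt (subset (3 ∷ 4 ∷ []))

  apex-off : dot pentagonal apex ≢ 0
  apex-off = from-no (dot pentagonal apex ℤ.≟ 0)

  pentagonal-facet : IsFacetOf (face pentagonal 0) LatticePt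
  pentagonal-facet = facet-by-affine-relations (L.drop 1 simplex)
    (face-isFace pentagonal 0 (λ S → All.lookup valid (allSubsets-complete 5 S)))
    (λ _ → proj₁) (λ _ → id) apex-lattice (apex-off ∘ proj₂)
    (All.map (λ (x-cut , on) → Equivalence.from (latticePt⇔cutVector _) x-cut , on) vertices-on) tied
    where
    valid : All (λ S → dot pentagonal (δ S) ≤ 0) (allSubsets 5)
    valid = from-yes (All.all? (λ S → dot pentagonal (δ S) ℤ.≤? 0) (allSubsets 5))
    vertices-on : All (λ x → x ∈ cutVectors × dot pentagonal x ≡ 0) (L.drop 1 simplex)
    vertices-on = from-yes (All.all? (λ x → x ∈? cutVectors ×-dec dot pentagonal x ℤ.≟ 0) (L.drop 1 simplex))
    on-or-off : All (λ x → dot pentagonal x ≡ 0 ⊎ x ∈ offPentagonal) cutVectors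
    on-or-off = from-yes (All.all? (λ x → dot pentagonal x ℤ.≟ 0 ⊎-dec x ∈? offPentagonal) cutVectors)
    tied : ∀ x → LatticePt x → face pentagonal 0 x ⊎ AffineRelation (L.drop 1 simplex) apex x
    tied x x-lat = Sum.map (x-lat ,_) (All.lookup tied-to-apex) (latticePts-satisfy on-or-off x-lat)

  pulling-simplex : Pulling ordering LatticePt (_∈ simplex)
  pulling-simplex = pulling-cone
    ([] , L.drop 1 ordering , refl , apex-lattice , []) pentagonal-facet (apex-off ∘ proj₂)
    (pulling-along-flag L.[ apex ] pentagonal 0 (L.drop 1 simplex) flag others refl pentagonal-flag)

  ordering-isOrdering : IsOrdering ordering
  ordering-isOrdering = from-yes (unique? ordering) , λ x →
    mk⇔ (λ x∈ → Equivalence.from (latticePt⇔cutVector x) (All.lookup ordering⊆cut x∈))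
        (latticePts-satisfy cut⊆ordering)
    where
    ordering⊆cut : All (_∈ cutVectors) ordering
    ordering⊆cut = from-yes (All.all? (_∈? cutVectors) ordering)
    cut⊆ordering : All (_∈ ordering) cutVectors
    cut⊆ordering = from-yes (All.all? (_∈? ordering) cutVectors)

  simplex-enumerated : Enumerates (V.fromList simplex) (_∈ simplex)
  simplex-enumerated x = mk⇔ ∈-fromList⁺ ∈-fromList⁻

  vol-simplex : vol (V.fromList simplex) ≡ 192
  vol-simplex = trans (vol≡∣det₀∣ (V.fromList simplex)) refl

  smallerSimplex : List Pt
  smallerSimplex = δ⟨ [] ⟩ ∷ δ⟨ 2 ∷ [] ⟩ ∷ δ⟨ 4 ∷ [] ⟩ ∷ δ⟨ 1 ∷ [] ⟩ ∷ δ⟨ 1 ∷ 3 ∷ 4 ∷ [] ⟩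
                 ∷ δ⟨ 1 ∷ 2 ∷ 3 ∷ 4 ∷ [] ⟩ ∷ δ⟨ 3 ∷ [] ⟩ ∷ apex ∷ δ⟨ 1 ∷ 3 ∷ [] ⟩
                 ∷ δ⟨ 1 ∷ 2 ∷ 3 ∷ [] ⟩ ∷ δ⟨ 2 ∷ 3 ∷ 4 ∷ [] ⟩ ∷ []

  smallerSimplex-latticePts : All LatticePt (V.toList (V.fromList smallerSimplex))
  smallerSimplex-latticePts = All.map (Equivalence.from (latticePt⇔cutVector _))
    (from-yes (All.all? (_∈? cutVectors) smallerSimplex))

  vol-smallerSimplex : vol (V.fromList smallerSimplex) ≡ 64
  vol-smallerSimplex = trans (vol≡∣det₀∣ (V.fromList smallerSimplex)) refl

lemma3p5 : ¬ CutK5Compressed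
lemma3p5 compressed = from-no (192 ℕ.≤? 64) (begin
  192                             ≡⟨ vol-simplex ⟨
  vol (V.fromList simplex)        ≤⟨ proj₂ simplex-minimal (V.fromList smallerSimplex) smallerSimplex-latticePts positive ⟩
  vol (V.fromList smallerSimplex) ≡⟨ vol-smallerSimplex ⟩
  64                              ∎)
  where
  open ℕP.≤-Reasoning
  simplex-minimal : MinimalVolume (V.fromList simplex)
  simplex-minimal =
    compressed ordering ordering-isOrdering (_∈ simplex) pulling-simplex (V.fromList simplex) simplex-enumerated
  positive : 0 ℕ.< vol (V.fromList smallerSimplex)
  positive = subst (0 ℕ.<_) (sym vol-smallerSimplex) (ℕ.s≤s ℕ.z≤n)
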